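{- Let $G=(X,E)$ be a symmetric 2-structure with colour set $C$, let $\mathcal{I}$ be an involution of $C$ without fixed point, and let $U\subset X$. Then $U$ is an involution module of $G$ (with respect to $\mathcal{I}$) if and only if none of the following two patterns occurs: (P1) there exist $u,v\in U$ and $a,b\in X\setminus U$ with $E(u,a)=E(v,a)$ and $E(u,b)=\mathcal{I}(E(v,b))$; (P2) there exist $u,v\in U$ and $a\in X\setminus U$ with $E(v,a)\notin\{E(u,a),\mathcal{I}(E(u,a))\}$.
   Context: A (symmetric) 2-structure is a pair $G=(X,E)$ with $X$ a finite set and $E:X^2\to\mathbb{N}$ satisfying $E(x,y)=E(y,x)$; its colour set is $C=\{E(u,v): u\neq v\}$. For $s\in X$, $i\in C$ and $X'\subseteq X$, let $N^i_s(X')=\{x\in X': E(s,x)=i\}$. Given an involution $\mathcal{I}$ of $C$ without fixed point, a set $U\subseteq X$ is an involution module if for all $u,v\in U$, either $N^i_u(X\setminus U)=N^{\mathcal{I}(i)}_v(X\setminus U)$ for all $i\in C$, or $N^i_u(X\setminus U)=N^{i}_v(X\setminus U)$ for all $i\in C$. -}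

module Defs where

open import Data.Nat using (ℕ)
open import Data.Fin using (Fin)
open import Data.Fin.Subset using (Subset; _∈_; _∉_)
open import Data.Product using (Σ; ∃; ∃-syntax; _×_)
open import Data.Sum using (_⊎_)
open import Relation.Binary.PropositionalEquality using (_≡_; _≢_)
open import Relation.Nullary using (¬_)
open import Function.Bundles using (_⇔_)

record TwoStructure (n : ℕ) : Set where
  field
    E   : Fin n → Fin n → ℕ
    sym : ∀ x y → E x y ≡ E y x

module _ {n : ℕ} (G : TwoStructure n) where
  open TwoStructure G

  InColourSet : ℕ → Set
  InColourSet c = ∃[ u ] ∃[ v ] (u ≢ v × E u v ≡ c)

  record FixedPointFreeInvolution (I : ℕ → ℕ) : Set where
    field
      closed     : ∀ c → InColourSet c → InColourSet (I c)
      involutive : ∀ c → InColourSet c → I (I c) ≡ c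
      noFixed    : ∀ c → InColourSet c → I c ≢ c

  -- N^i_s(X \ U) = N^j_t(X \ U), as equality of subsets of X \ U.
  SameNbhd : Subset n → Fin n → ℕ → Fin n → ℕ → Set
  SameNbhd U s i t j = ∀ x → x ∉ U → (E s x ≡ i ⇔ E t x ≡ j)

  IsInvolutionModule : (ℕ → ℕ) → Subset n → Set
  IsInvolutionModule I U =
    ∀ u v → u ∈ U → v ∈ U →
      (∀ i → InColourSet i → SameNbhd U u i v (I i))
      ⊎ (∀ i → InColourSet i → SameNbhd U u i v i)

  PatternP1 : (ℕ → ℕ) → Subset n → Set
  PatternP1 I U = ∃[ u ] ∃[ v ] ∃[ a ] ∃[ b ]
    (u ∈ U × v ∈ U × a ∉ U × b ∉ U × E u a ≡ E v a × E u b ≡ I (E v b))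

  PatternP2 : (ℕ → ℕ) → Subset n → Set
  PatternP2 I U = ∃[ u ] ∃[ v ] ∃[ a ]
    (u ∈ U × v ∈ U × a ∉ U × E v a ≢ E u a × E v a ≢ I (E u a))

module Submission where

-- For u, v ∈ U call v a *twin* of u outside U if E(u,x) = E(v,x) for every
-- x ∉ U, and a *mirror* of u if E(v,x) = I(E(u,x)) for every x ∉ U.
--  * Since every edge leaving U carries a colour of C, the two neighbourhood
--    conditions in the definition of an involution module say exactly that
--    v is a mirror, resp. a twin, of u; so U is an involution module iff any
--    two vertices of U are mirrors or twins of each other.
--  * As I has no fixed point, u and v cannot agree and be mirrored at the
--    same outside vertex; this rules out (P1) and (P2) for modules.
--  * Conversely, absence of (P2) means that at each outside vertex u and v
--    agree or are mirrored, and absence of (P1) means they cannot do both at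
--    different outside vertices; deciding whether they ever disagree
--    (X is finite) then shows that v is a twin or a mirror of u.

open import Defs
open import Data.Nat using (ℕ)
open import Data.Nat.Properties using (_≟_)
open import Data.Fin using (Fin)
open import Data.Fin.Properties using (any?)
open import Data.Fin.Subset using (Subset; _∈_; _∉_)
open import Data.Fin.Subset.Properties using (_∈?_)
open import Data.Product using (_×_; _,_)
open import Data.Sum using (_⊎_; inj₁; inj₂; [_,_])
open import Data.Empty using (⊥-elim)
open import Relation.Nullary using (¬_; yes; no)
open import Relation.Nullary.Decidable using (¬?; _×-dec_)
open import Relation.Binary.PropositionalEquality
  using (_≡_; _≢_; refl; sym; trans; cong; module ≡-Reasoning)
open import Function.Base using (_∘_; id)
open import Function.Bundles using (_⇔_; mk⇔; Equivalence)

module InvolutionModules {n : ℕ} (G : TwoStructure n) {I : ℕ → ℕ}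
                         (F : FixedPointFreeInvolution G I) (U : Subset n) where
  open TwoStructure G using (E)
  open FixedPointFreeInvolution F

  colourOutside : ∀ {u x} → u ∈ U → x ∉ U → InColourSet G (E u x)
  colourOutside u∈U x∉U = _ , _ , (λ { refl → x∉U u∈U }) , refl

  Twins : Fin n → Fin n → Set
  Twins u v = ∀ x → x ∉ U → E v x ≡ E u x

  Mirrors : Fin n → Fin n → Set
  Mirrors u v = ∀ x → x ∉ U → E v x ≡ I (E u x)

  mirrored-sym : ∀ {u v x} → u ∈ U → x ∉ U → E v x ≡ I (E u x) → E u x ≡ I (E v x)
  mirrored-sym {u} {v} {x} u∈U x∉U mirrored = begin
    E u x         ≡⟨ sym (involutive (E u x) (colourOutside u∈U x∉U)) ⟩
    I (I (E u x)) ≡⟨ cong I (sym mirrored) ⟩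
    I (E v x)     ∎
    where open ≡-Reasoning

  -- Since I has no fixed point, u and v cannot both agree and be mirrored at x.
  agreeing⇒notMirrored : ∀ {u v x} → u ∈ U → x ∉ U →
                         E v x ≡ E u x → E v x ≢ I (E u x)
  agreeing⇒notMirrored u∈U x∉U agree mirrored =
    noFixed _ (colourOutside u∈U x∉U) (sym (trans (sym agree) mirrored))

  sameNbhd⇒twins : ∀ {u v} → u ∈ U →
                   (∀ i → InColourSet G i → SameNbhd G U u i v i) → Twins u v
  sameNbhd⇒twins u∈U same x x∉U =
    Equivalence.to (same _ (colourOutside u∈U x∉U) x x∉U) refl

  twins⇒sameNbhd : ∀ {u v} → Twins u v →
                   ∀ i → InColourSet G i → SameNbhd G U u i v i
  twins⇒sameNbhd twins i _ x x∉U =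
    mk⇔ (trans (twins x x∉U)) (trans (sym (twins x x∉U)))

  mirrorNbhd⇒mirrors : ∀ {u v} → u ∈ U →
                       (∀ i → InColourSet G i → SameNbhd G U u i v (I i)) → Mirrors u v
  mirrorNbhd⇒mirrors u∈U same x x∉U =
    Equivalence.to (same _ (colourOutside u∈U x∉U) x x∉U) refl

  mirrors⇒mirrorNbhd : ∀ {u v} → u ∈ U → Mirrors u v →
                       ∀ i → InColourSet G i → SameNbhd G U u i v (I i)
  mirrors⇒mirrorNbhd {u} {v} u∈U mirrors i i∈C x x∉U =
    mk⇔ (λ e → trans (mirrors x x∉U) (cong I e))
        (λ e → begin
          E u x     ≡⟨ mirrored-sym u∈U x∉U (mirrors x x∉U) ⟩
          I (E v x) ≡⟨ cong I e ⟩
          I (I i)   ≡⟨ involutive i i∈C ⟩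
          i         ∎)
    where open ≡-Reasoning

  module⇔mirrorsOrTwins :
    IsInvolutionModule G I U ⇔
    (∀ u v → u ∈ U → v ∈ U → Mirrors u v ⊎ Twins u v)
  module⇔mirrorsOrTwins = mk⇔
    (λ M u v u∈U v∈U →
      [ inj₁ ∘ mirrorNbhd⇒mirrors u∈U , inj₂ ∘ sameNbhd⇒twins u∈U ] (M u v u∈U v∈U))
    (λ R u v u∈U v∈U →
      [ inj₁ ∘ mirrors⇒mirrorNbhd u∈U , inj₂ ∘ twins⇒sameNbhd ] (R u v u∈U v∈U))

  -- Pairwise mirrors-or-twins excludes (P1): u, v would have to agree at one
  -- outside vertex and be mirrored at another.
  mirrorsOrTwins⇒¬P1 : (∀ u v → u ∈ U → v ∈ U → Mirrors u v ⊎ Twins u v) →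
                        ¬ PatternP1 G I U
  mirrorsOrTwins⇒¬P1 R (u , v , a , b , u∈U , v∈U , a∉U , b∉U , agreeₐ , mirroredᵦ)
    with R u v u∈U v∈U
  ... | inj₁ mirrors = agreeing⇒notMirrored u∈U a∉U (sym agreeₐ) (mirrors a a∉U)
  ... | inj₂ twins   = agreeing⇒notMirrored v∈U b∉U (sym (twins b b∉U)) mirroredᵦ

  mirrorsOrTwins⇒¬P2 : (∀ u v → u ∈ U → v ∈ U → Mirrors u v ⊎ Twins u v) →
                        ¬ PatternP2 G I U
  mirrorsOrTwins⇒¬P2 R (u , v , a , u∈U , v∈U , a∉U , notAgree , notMirrored)
    with R u v u∈U v∈U
  ... | inj₁ mirrors = notMirrored (mirrors a a∉U)
  ... | inj₂ twins   = notAgree (twins a a∉U)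

  agreeOrMirrored : ¬ PatternP2 G I U → ∀ {u v x} → u ∈ U → v ∈ U → x ∉ U →
                    E v x ≡ E u x ⊎ E v x ≡ I (E u x)
  agreeOrMirrored ¬P2 {u} {v} {x} u∈U v∈U x∉U with E v x ≟ E u x | E v x ≟ I (E u x)
  ... | yes agree | _             = inj₁ agree
  ... | no _      | yes mirrored  = inj₂ mirrored
  ... | no ¬agree | no ¬mirrored  = ⊥-elim (¬P2 (u , v , x , u∈U , v∈U , x∉U , ¬agree , ¬mirrored))

  mirroredSomewhere⇒mirrors : ¬ PatternP1 G I U → ¬ PatternP2 G I U →
                              ∀ {u v a} → u ∈ U → v ∈ U → a ∉ U →
                              E v a ≡ I (E u a) → Mirrors u v
  mirroredSomewhere⇒mirrors ¬P1 ¬P2 {u} {v} {a} u∈U v∈U a∉U mirroredₐ x x∉U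
    with agreeOrMirrored ¬P2 u∈U v∈U x∉U
  ... | inj₂ mirrored = mirrored
  ... | inj₁ agree    = ⊥-elim (¬P1 (u , v , x , a , u∈U , v∈U , x∉U , a∉U ,
                                      sym agree , mirrored-sym u∈U a∉U mirroredₐ))

  -- Without (P1) and (P2), any two vertices of U are mirrors or twins:
  -- either they disagree at some outside vertex (hence are mirrored there)
  -- or they agree at all of them.
  noPatterns⇒mirrorsOrTwins : ¬ PatternP1 G I U → ¬ PatternP2 G I U →
                              ∀ u v → u ∈ U → v ∈ U → Mirrors u v ⊎ Twins u v
  noPatterns⇒mirrorsOrTwins ¬P1 ¬P2 u v u∈U v∈U
    with any? (λ a → ¬? (a ∈? U) ×-dec ¬? (E v a ≟ E u a))
  ... | yes (a , a∉U , ¬agreeₐ) =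
          inj₁ (mirroredSomewhere⇒mirrors ¬P1 ¬P2 u∈U v∈U a∉U mirroredₐ)
    where
    mirroredₐ : E v a ≡ I (E u a)
    mirroredₐ = [ (λ agree → ⊥-elim (¬agreeₐ agree)) , id ]
                  (agreeOrMirrored ¬P2 u∈U v∈U a∉U)
  ... | no noDisagreement = inj₂ agreeEverywhere
    where
    agreeEverywhere : Twins u v
    agreeEverywhere x x∉U with E v x ≟ E u x
    ... | yes agree  = agree
    ... | no ¬agree  = ⊥-elim (noDisagreement (x , x∉U , ¬agree))

mainTheorem1 : (n : ℕ) (G : TwoStructure n) (I : ℕ → ℕ) → FixedPointFreeInvolution G I → (U : Subset n) → IsInvolutionModule G I U ⇔ (¬ PatternP1 G I U × ¬ PatternP2 G I U)
mainTheorem1 n G I F U = mk⇔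
  (λ M → let R = to M in mirrorsOrTwins⇒¬P1 R , mirrorsOrTwins⇒¬P2 R)
  (λ { (¬P1 , ¬P2) → from (noPatterns⇒mirrorsOrTwins ¬P1 ¬P2) })
  where
  open InvolutionModules G F U
  open Equivalence module⇔mirrorsOrTwins
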